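{- Let $A$ be a regular system of divisors and $n\in\mathbb N$. Then \[ \Phi_{A,n}(x)=\prod_{\substack{d\mid n\\ \gamma_A(n)\mid d}}\Phi_d(x), \] where $\Phi_d(x)$ is the classical $d$-th cyclotomic polynomial.
   Context: A regular system of divisors is a family $A=(A(n))_{n\in\mathbb N}$, where each $A(n)$ is a set of positive divisors of $n$, such that: (i) $A(1)=\{1\}$ and $A(mn)=\{de: d\in A(m), e\in A(n)\}$ whenever $\gcd(m,n)=1$; (ii) for every prime power $p^a$ ($a\ge1$) there is a divisor $t=t_A(p^a)$ of $a$ (the type of $p^a$) such that $A(p^{it})=\{1,p^t,\dots,p^{it}\}$ for every $0\le i\le a/t$. For $j\in\mathbb Z$, $(j,n)_A=\max\{d\in\mathbb N: d\mid j,\ d\in A(n)\}$; $\zeta_n=e^{2\pi i/n}$; $\Phi_{A,n}(x)=\prod_{1\le j\le n,\ (j,n)_A=1}(x-\zeta_n^j)$. The $A$-core is $\gamma_A(n)=\prod_{p^a\parallel n}p^{a-t_A(p^a)+1}$, the product over the prime powers exactly dividing $n$. -}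

module Defs where

open import Level using (Level)
open import Data.Nat using (ℕ; zero; suc; _+_; _*_; _∸_; _^_; _≤_; _<_; _⊔_)
open import Data.Nat.Divisibility using (_∣_; _∣?_; divides)
open import Data.Nat.Primality using (Prime; prime?)
open import Data.Nat.Coprimality using (Coprime)
open import Data.Nat.GCD using (gcd)
open import Data.List using (List; []; _∷_; map; foldr; filter; upTo)
open import Data.Nat.ListAction using (product)
open import Data.Product using (Σ; _×_; _,_)
open import Relation.Nullary using (Dec; yes; no; ¬_)
open import Relation.Nullary.Decidable using (_×-dec_)
open import Relation.Binary.PropositionalEquality using (_≡_)
open import Algebra.Bundles using (CommutativeRing)

range1 : ℕ → List ℕ
range1 n = map suc (upTo n)

-- Regular systems of divisors.  mem n d  means  d ∈ A(n).

record RegularSystem : Set₁ where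
  field
    mem    : ℕ → ℕ → Set
    decMem : ∀ n d → Dec (mem n d)
    sub    : ∀ n d → mem n d → d ∣ n
    memOne : ∀ d → (mem 1 d → d ≡ 1) × (d ≡ 1 → mem 1 d)
    mult   : ∀ m n → Coprime m n → ∀ d →
               (mem (m * n) d → Σ ℕ λ e → Σ ℕ λ f → mem m e × mem n f × d ≡ e * f)
             × ((Σ ℕ λ e → Σ ℕ λ f → mem m e × mem n f × d ≡ e * f) → mem (m * n) d)
    -- (ii)  type t p a of the prime power p^a
    type     : ℕ → ℕ → ℕ
    typeDiv  : ∀ p a → Prime p → 1 ≤ a → type p a ∣ a
    typeSpec : ∀ p a → Prime p → 1 ≤ a → ∀ i → i * type p a ≤ a → ∀ d →
                 (mem (p ^ (i * type p a)) d → Σ ℕ λ k → k ≤ i × d ≡ p ^ (k * type p a))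
               × ((Σ ℕ λ k → k ≤ i × d ≡ p ^ (k * type p a)) → mem (p ^ (i * type p a)) d)

open RegularSystem public

-- (j,n)_A = max { d : d ∣ j, d ∈ A(n) }   (for 1 ≤ j ≤ n all such d lie in [1..n])
gcdA : RegularSystem → ℕ → ℕ → ℕ
gcdA A j n = foldr _⊔_ 0 (filter (λ d → (d ∣? j) ×-dec decMem A n d) (range1 n))

-- multiplicity of p in n (with fuel); used for p prime, n ≥ 1
valF : ℕ → ℕ → ℕ → ℕ
valF zero p n = 0
valF (suc f) p n with p ∣? n
... | yes (divides q _) = suc (valF f p q)
... | no _ = 0

val : ℕ → ℕ → ℕ
val p n = valF n p n

gammaA : RegularSystem → ℕ → ℕ
gammaA A n = product (map (λ p → p ^ (val p n ∸ type A p (val p n) + 1))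
                        (filter (λ p → prime? p ×-dec (p ∣? n)) (range1 n)))

-- Polynomials over a commutative ring, as coefficient lists (lowest degree first)

module Poly {c ℓ : Level} (R : CommutativeRing c ℓ) where
  open CommutativeRing R using (Carrier; _≈_; 0#; 1#; -_)
    renaming (_+_ to _⊕_; _*_ to _⊗_)

  Pol : Set c
  Pol = List Carrier

  pow : Carrier → ℕ → Carrier
  pow x zero = 1#
  pow x (suc k) = x ⊗ pow x k

  _+P_ : Pol → Pol → Pol
  [] +P q = q
  (a ∷ p) +P [] = a ∷ p
  (a ∷ p) +P (b ∷ q) = (a ⊕ b) ∷ (p +P q)

  _*P_ : Pol → Pol → Pol
  [] *P q = []
  (a ∷ p) *P q = map (a ⊗_) q +P (0# ∷ (p *P q))

  X-_ : Carrier → Pol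
  X- a = (- a) ∷ 1# ∷ []

  prodP : List Pol → Pol
  prodP = foldr _*P_ (1# ∷ [])

  -- ζ is a coherent family of primitive roots of unity (as e^{2πi/m} in ℂ)
  record RootFamily (ζ : ℕ → Carrier) : Set (c Level.⊔ ℓ) where
    field
      rootOne   : ∀ m → 1 ≤ m → pow (ζ m) m ≈ 1#
      isPrimitive : ∀ m k → 1 ≤ k → k < m → ¬ (pow (ζ m) k ≈ 1#)
      coherent  : ∀ m d k → 1 ≤ m → Data.Nat._*_ d k ≡ m → pow (ζ m) k ≈ ζ d

  cyclo : (ℕ → Carrier) → ℕ → Pol
  cyclo ζ d = prodP (map (λ k → X- pow (ζ d) k)
                      (filter (λ k → gcd k d Data.Nat.≟ 1) (range1 d)))

  cycloA : (ℕ → Carrier) → RegularSystem → ℕ → Pol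
  cycloA ζ A n = prodP (map (λ j → X- pow (ζ n) j)
                         (filter (λ j → gcdA A j n Data.Nat.≟ 1) (range1 n)))

  cycloProd : (ℕ → Carrier) → RegularSystem → ℕ → Pol
  cycloProd ζ A n = prodP (map (cyclo ζ)
                            (filter (λ d → (d ∣? n) ×-dec (gammaA A n ∣? d)) (range1 n)))

-- For p^a ∥ n and t = t_A(p^a), one has (j,n)_A = 1 iff no such p^t divides j.  Writing
-- n = gcd(j,n)·m and comparing p-adic valuations, p^t ∤ j iff p^(a-t+1) ∣ m; hence (j,n)_A = 1
-- iff γ_A(n) ∣ n / gcd(j,n).  Grouping j ∈ [1..n] by d = n / gcd(j,n) is the classical partition
-- j = (n/d)·k with d ∣ n, gcd(k,d) = 1, and ζ_n^((n/d)k) = ζ_d^k.  So the linear factors of Φ_{A,n}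
-- are, up to order, those of the Φ_d with d ∣ n and γ_A(n) ∣ d.

module Submission where

open import Defs
open import Level using (Level)
open import Data.Nat using (ℕ; _≤_)
open import Data.List.Relation.Binary.Pointwise using (Pointwise)
open import Algebra.Bundles using (CommutativeRing)

open import Level using (0ℓ)
open import Data.Nat.Base
  using (zero; suc; _+_; _*_; _∸_; _^_; _<_; _⊔_; z≤n; s≤s; >-nonZero; nonTrivial⇒n>1)
open import Data.Nat.Properties
open import Data.Nat.Divisibility
open import Data.Nat.DivMod using (_/_; m*[n/m]≡n; m*n/n≡m)
open import Data.Nat.GCD using (gcd; gcd[m,n]∣m; gcd[m,n]∣n; gcd-greatest; c*gcd[m,n]≡gcd[cm,cn])
open import Data.Nat.Coprimality using (Coprime; coprime-divisor)
open import Data.Nat.Primality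
  using (Prime; prime?; ¬prime[1]; euclidsLemma; prime⇒irreducible; prime⇒nonZero; prime⇒nonTrivial)
open import Data.Nat.Primality.Factorisation using (factorise)
open import Data.Nat.Induction using (<-rec)
open import Data.Nat.ListAction using (product)
open import Data.Nat.ListAction.Properties using (∈⇒∣product)
open import Data.List.Base using (List; []; _∷_; map; foldr; filter; concatMap; length; _++_)
open import Data.List.Relation.Binary.Pointwise using ([]; _∷_)
open import Data.List.Properties using (map-∘; map-concatMap; length-map)
open import Data.List.Membership.Propositional using (_∈_; find; lose)
open import Data.List.Membership.Propositional.Properties
  using (∈-map⁺; ∈-map⁻; ∈-upTo⁺; ∈-upTo⁻; ∈-filter⁺; ∈-filter⁻; ∈-concatMap⁺; ∈-concatMap⁻)
open import Data.List.Membership.Propositional.Properties.WithK using (unique∧set⇒bag)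
open import Data.List.Relation.Binary.BagAndSetEquality using (∼bag⇒↭)
open import Data.List.Relation.Binary.Permutation.Propositional as ↭ using (_↭_)
import Data.List.Relation.Binary.Permutation.Propositional.Properties as ↭ₚ
open import Data.List.Relation.Unary.All as All using (All; []; _∷_)
open import Data.List.Relation.Unary.Any using (here; there)
open import Data.List.Relation.Unary.AllPairs using ([]; _∷_)
open import Data.List.Relation.Unary.Unique.Propositional using (Unique)
import Data.List.Relation.Unary.Unique.Propositional.Properties as Unique
open import Data.Product.Base using (∃-syntax; _×_; _,_; proj₁; proj₂)
open import Data.Sum.Base using (inj₁; inj₂)
open import Function.Base using (_∘_)
open import Function.Bundles using (_⇔_; mk⇔; Equivalence)
open import Relation.Unary using (Pred; Decidable)
open import Relation.Nullary using (¬_; yes; no)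
open import Relation.Nullary.Decidable using (_×-dec_)
open import Relation.Nullary.Negation using (contradiction)
open import Relation.Binary.PropositionalEquality
  using (_≡_; _≢_; refl; sym; trans; cong; subst; subst₂; module ≡-Reasoning)

-- Divisibility, primes and p-adic valuations

m∣n⇒0<m : ∀ {m n} → 0 < n → m ∣ n → 0 < m
m∣n⇒0<m {zero}  0<n 0∣n = contradiction (subst (0 <_) (0∣⇒≡0 0∣n) 0<n) (<-irrefl refl)
m∣n⇒0<m {suc m} _   _   = s≤s z≤n

p^b∣p^a : ∀ p {b a} → b ≤ a → p ^ b ∣ p ^ a
p^b∣p^a p {b} {a} b≤a = divides (p ^ (a ∸ b)) (begin
  p ^ a               ≡⟨ cong (p ^_) (m+[n∸m]≡n b≤a) ⟨
  p ^ (b + (a ∸ b))   ≡⟨ ^-distribˡ-+-* p b (a ∸ b) ⟩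
  p ^ b * p ^ (a ∸ b) ≡⟨ *-comm (p ^ b) _ ⟩
  p ^ (a ∸ b) * p ^ b ∎)
  where open ≡-Reasoning

n∣n^k : ∀ n {k} → 0 < k → n ∣ n ^ k
n∣n^k n {suc k} _ = ∣m⇒∣m*n (n ^ k) ∣-refl

t+[a∸t+1]≡1+a : ∀ {t a} → t ≤ a → t + (a ∸ t + 1) ≡ suc a
t+[a∸t+1]≡1+a {t} {a} t≤a = begin
  t + (a ∸ t + 1)   ≡⟨ +-assoc t (a ∸ t) 1 ⟨
  t + (a ∸ t) + 1   ≡⟨ cong (_+ 1) (m+[n∸m]≡n t≤a) ⟩
  a + 1             ≡⟨ +-comm a 1 ⟩
  suc a             ∎
  where open ≡-Reasoning

prime>1 : ∀ {p} → Prime p → 1 < p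
prime>1 {p} pp = nonTrivial⇒n>1 p {{prime⇒nonTrivial pp}}

prime∤1 : ∀ {p} → Prime p → ¬ p ∣ 1
prime∤1 pp p∣1 = ¬prime[1] (subst Prime (∣1⇒≡1 p∣1) pp)

prime∣prime⇒≡ : ∀ {p q} → Prime p → Prime q → p ∣ q → p ≡ q
prime∣prime⇒≡ pp pq p∣q with prime⇒irreducible pq p∣q
... | inj₁ p≡1 = contradiction (subst Prime p≡1 pp) ¬prime[1]
... | inj₂ p≡q = p≡q

prime∣m^k⇒prime∣m : ∀ {p} m k → Prime p → p ∣ m ^ k → p ∣ m
prime∣m^k⇒prime∣m m zero    pp p∣1 = contradiction p∣1 (prime∤1 pp)
prime∣m^k⇒prime∣m m (suc k) pp p∣m*m^k with euclidsLemma m (m ^ k) pp p∣m*m^k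
... | inj₁ p∣m   = p∣m
... | inj₂ p∣m^k = prime∣m^k⇒prime∣m m k pp p∣m^k

∃-prime-divisor : ∀ {n} → 1 < n → ∃[ p ] Prime p × p ∣ n
∃-prime-divisor {n} 1<n with factorise n {{>-nonZero (<⇒≤ 1<n)}}
... | record { factors = [] ; isFactorisation = n≡1 } = contradiction n≡1 (>⇒≢ 1<n)
... | record { factors = p ∷ ps ; isFactorisation = n≡p*ps ; factorsPrime = pp ∷ _ } =
  p , pp , divides (product ps) (trans n≡p*ps (*-comm p (product ps)))

no-prime-divisor⇒≡1 : ∀ {d} → 0 < d → (∀ {p} → Prime p → ¬ p ∣ d) → d ≡ 1
no-prime-divisor⇒≡1 {d} 0<d no-p with d ≟ 1
... | yes d≡1 = d≡1
... | no  d≢1 with ∃-prime-divisor (≤∧≢⇒< 0<d (d≢1 ∘ sym))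
...   | p , pp , p∣d = contradiction p∣d (no-p pp)

no-common-prime⇒coprime : ∀ {m n} → 0 < m → (∀ {p} → Prime p → p ∣ m → ¬ p ∣ n) → Coprime m n
no-common-prime⇒coprime 0<m disjoint (d∣m , d∣n) =
  no-prime-divisor⇒≡1 (m∣n⇒0<m 0<m d∣m) λ pp p∣d →
    disjoint pp (∣-trans p∣d d∣m) (∣-trans p∣d d∣n)

p∤m⇒coprime[p^a,m] : ∀ {p m} a → Prime p → ¬ p ∣ m → Coprime (p ^ a) m
p∤m⇒coprime[p^a,m] {p} a pp p∤m = no-common-prime⇒coprime (m^n>0 p {{prime⇒nonZero pp}} a)
  λ qp q∣p^a → subst (λ r → ¬ r ∣ _) (sym (prime∣prime⇒≡ qp pp (prime∣m^k⇒prime∣m p a qp q∣p^a))) p∤m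

p^valF∣n : ∀ f p n → p ^ valF f p n ∣ n
p^valF∣n zero    p n = 1∣ n
p^valF∣n (suc f) p n with p ∣? n
... | yes (divides q n≡q*p) =
  subst (p * p ^ valF f p q ∣_) (trans (*-comm p q) (sym n≡q*p)) (*-monoʳ-∣ p (p^valF∣n f p q))
... | no  _ = 1∣ n

p^[1+valF]∤n : ∀ f {p n} → 1 < p → 0 < n → n ≤ f → ¬ p ^ suc (valF f p n) ∣ n
p^[1+valF]∤n zero    1<p 0<n n≤0 _ = contradiction (≤-trans 0<n n≤0) λ ()
p^[1+valF]∤n (suc f) {p} {n} 1<p 0<n n≤1+f p^[1+v]∣n with p ∣? n
... | no  p∤n = p∤n (∣-trans (∣m⇒∣m*n _ ∣-refl) p^[1+v]∣n)
... | yes (divides q n≡q*p) = p^[1+valF]∤n f 1<p 0<q (<⇒≤pred (≤-trans q<n n≤1+f))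
        (*-cancelˡ-∣ p (subst (p ^ suc (suc (valF f p q)) ∣_) n≡p*q p^[1+v]∣n))
  where
  instance _ = >-nonZero (<⇒≤ 1<p)
  n≡p*q : n ≡ p * q
  n≡p*q = trans n≡q*p (*-comm q p)
  0<q : 0 < q
  0<q = m∣n⇒0<m 0<n (divides p (trans n≡q*p (*-comm q p)))
  q<n : q < n
  q<n = subst (q <_) (sym n≡q*p) (m<m*n q p {{>-nonZero 0<q}} 1<p)

p^val∣n : ∀ p n → p ^ val p n ∣ n
p^val∣n p n = p^valF∣n n p n

p^[1+val]∤n : ∀ {p n} → 1 < p → 0 < n → ¬ p ^ suc (val p n) ∣ n
p^[1+val]∤n {n = n} 1<p 0<n = p^[1+valF]∤n n 1<p 0<n ≤-refl

p∣n⇒0<val : ∀ {p n} → 0 < n → p ∣ n → 0 < val p n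
p∣n⇒0<val {p} {suc n} _ p∣n with p ∣? suc n
... | yes _   = s≤s z≤n
... | no  p∤n = contradiction p∣n p∤n

n≡p^val*rest : ∀ {p n} → Prime p → 0 < n → ∃[ r ] n ≡ p ^ val p n * r × ¬ p ∣ r
n≡p^val*rest {p} {n} pp 0<n with p^val∣n p n
... | divides r n≡r*p^v = r , trans n≡r*p^v (*-comm r _) , λ p∣r →
  p^[1+val]∤n (prime>1 pp) 0<n
    (subst (p ^ suc (val p n) ∣_) (sym n≡r*p^v) (*-monoˡ-∣ (p ^ val p n) p∣r))

p^a∣m*n∧p^t∤m⇒p^b∣n : ∀ {p} t {a b m n} → Prime p → t + b ≡ suc a →
                      p ^ a ∣ m * n → ¬ p ^ t ∣ m → p ^ b ∣ n
p^a∣m*n∧p^t∤m⇒p^b∣n zero _ _ _ p^0∤m = contradiction (1∣ _) p^0∤m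
p^a∣m*n∧p^t∤m⇒p^b∣n {p} (suc s) {b = b} {m} pp refl p^a∣mn p^t∤m with p ∣? m
... | no p∤m =
  coprime-divisor (p∤m⇒coprime[p^a,m] b pp p∤m) (∣-trans (p^b∣p^a p (m≤n+m b s)) p^a∣mn)
p^a∣m*n∧p^t∤m⇒p^b∣n (suc zero) pp refl _ p∤m | yes p∣m =
  contradiction (∣-trans (∣-reflexive (*-identityʳ _)) p∣m) p∤m
p^a∣m*n∧p^t∤m⇒p^b∣n {p} (suc (suc s)) {b = b} {n = n} pp refl p^a∣mn p^t∤m
  | yes (divides m' refl) =
  p^a∣m*n∧p^t∤m⇒p^b∣n (suc s) {m = m'} pp refl
    (*-cancelˡ-∣ p (subst (p ^ suc (s + b) ∣_) m'*p*n≡p*[m'*n] p^a∣mn))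
    (λ p^t∣m' → p^t∤m (subst (_∣ m' * p) (*-comm _ p) (*-monoˡ-∣ p p^t∣m')))
  where
  instance _ = prime⇒nonZero pp
  m'*p*n≡p*[m'*n] : m' * p * n ≡ p * (m' * n)
  m'*p*n≡p*[m'*n] = trans (cong (_* n) (*-comm m' p)) (*-assoc p m' n)

module _ (e : ℕ → ℕ) where

  prime∤product-of-powers : ∀ {p qs} → Prime p → All Prime qs → All (p ≢_) qs →
                            ¬ p ∣ product (map (λ q → q ^ e q) qs)
  prime∤product-of-powers pp []         []           p∣1 = prime∤1 pp p∣1
  prime∤product-of-powers {p} pp (_∷_ {q} qp qsp) (p≢q ∷ p≢qs) p∣prod
    with euclidsLemma (q ^ e q) _ pp p∣prod
  ... | inj₁ p∣q^e = p≢q (prime∣prime⇒≡ pp qp (prime∣m^k⇒prime∣m q (e q) pp p∣q^e))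
  ... | inj₂ p∣rest = prime∤product-of-powers pp qsp p≢qs p∣rest

  product-of-prime-powers-∣ : ∀ {ps m} → Unique ps → All Prime ps →
                              All (λ p → p ^ e p ∣ m) ps → product (map (λ p → p ^ e p) ps) ∣ m
  product-of-prime-powers-∣ {m = m} [] [] [] = 1∣ m
  product-of-prime-powers-∣ {p ∷ ps} (p∉ps ∷ unique) (pp ∷ psp) (p^e∣m ∷ ps^e∣m)
    with product-of-prime-powers-∣ unique psp ps^e∣m
  ... | divides c m≡c*P = subst (p ^ e p * P ∣_) (sym m≡c*P) (*-monoˡ-∣ P p^e∣c)
    where
    P : ℕ
    P = product (map (λ q → q ^ e q) ps)
    p^e∣c : p ^ e p ∣ c
    p^e∣c = coprime-divisor (p∤m⇒coprime[p^a,m] (e p) pp (prime∤product-of-powers pp psp p∉ps))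
              (subst (p ^ e p ∣_) (trans m≡c*P (*-comm c P)) p^e∣m)

∈-range1⁺ : ∀ {x n} → 0 < x → x ≤ n → x ∈ range1 n
∈-range1⁺ {suc x} _ (s≤s x≤n) = ∈-map⁺ suc (∈-upTo⁺ (s≤s x≤n))

∈-range1⁻ : ∀ {x n} → x ∈ range1 n → 0 < x × x ≤ n
∈-range1⁻ x∈ with ∈-map⁻ suc x∈
... | y , y∈ , refl = s≤s z≤n , ∈-upTo⁻ y∈

∣⇒∈-range1 : ∀ {d n} → 0 < n → d ∣ n → d ∈ range1 n
∣⇒∈-range1 0<n d∣n = ∈-range1⁺ (m∣n⇒0<m 0<n d∣n) (∣⇒≤ {{>-nonZero 0<n}} d∣n)

range1-unique : ∀ n → Unique (range1 n)
range1-unique n = Unique.map⁺ suc-injective (Unique.upTo⁺ n)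

∈⇒≤foldr-⊔ : ∀ {x} xs → x ∈ xs → x ≤ foldr _⊔_ 0 xs
∈⇒≤foldr-⊔ (y ∷ xs) (here refl) = m≤m⊔n y _
∈⇒≤foldr-⊔ (y ∷ xs) (there x∈) = ≤-trans (∈⇒≤foldr-⊔ xs x∈) (m≤n⊔m y _)

foldr-⊔-≤ : ∀ {b xs} → All (_≤ b) xs → foldr _⊔_ 0 xs ≤ b
foldr-⊔-≤ []           = z≤n
foldr-⊔-≤ (x≤b ∷ xs≤b) = ⊔-lub x≤b (foldr-⊔-≤ xs≤b)

Unique-concatMap⁺ : ∀ {a b} {A : Set a} {B : Set b} (f : A → List B) {xs} → Unique xs →
                    (∀ {x} → x ∈ xs → Unique (f x)) →
                    (∀ {x y v} → x ∈ xs → y ∈ xs → v ∈ f x → v ∈ f y → x ≡ y) →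
                    Unique (concatMap f xs)
Unique-concatMap⁺ f {[]}     _                _        _          = []
Unique-concatMap⁺ f {x ∷ xs} (x∉xs ∷ unique) unique-f determines =
  Unique.++⁺ (unique-f (here refl))
    (Unique-concatMap⁺ f unique (unique-f ∘ there) λ x∈ y∈ → determines (there x∈) (there y∈))
    λ (v∈fx , v∈rest) → let y , y∈xs , v∈fy = find (∈-concatMap⁻ f {xs = xs} v∈rest) in
      All.lookup x∉xs y∈xs (determines (here refl) (there y∈xs) v∈fx v∈fy)

-- Regular systems of divisors

module _ (A : RegularSystem) where

  -- For p^a ∥ n: typeAt n p = t_A(p^a), and coreExponent n p = a - t_A(p^a) + 1 is the exponent
  -- of p in γ_A(n).
  typeAt : ℕ → ℕ → ℕ
  typeAt n p = type A p (val p n)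

  coreExponent : ℕ → ℕ → ℕ
  coreExponent n p = val p n ∸ typeAt n p + 1

  0<type : ∀ {p a} → Prime p → 0 < a → 0 < type A p a
  0<type {p} {a} pp 0<a = m∣n⇒0<m 0<a (typeDiv A p a pp 0<a)

  type≤ : ∀ {p a} → Prime p → 0 < a → type A p a ≤ a
  type≤ {p} {a} pp 0<a = ∣⇒≤ {{>-nonZero 0<a}} (typeDiv A p a pp 0<a)

  mem-p^a⁻ : ∀ {p a d} → Prime p → 0 < a → mem A (p ^ a) d → ∃[ k ] d ≡ p ^ (k * type A p a)
  mem-p^a⁻ {p} {a} {d} pp 0<a d∈A with typeDiv A p a pp 0<a
  ... | divides i a≡i*t
    with proj₁ (typeSpec A p a pp 0<a i (≤-reflexive (sym a≡i*t)) d)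
               (subst (λ x → mem A (p ^ x) d) a≡i*t d∈A)
  ...   | k , _ , d≡p^kt = k , d≡p^kt

  mem-p^a⁺ : ∀ {p a} k → Prime p → 0 < a → k * type A p a ≤ a →
             mem A (p ^ a) (p ^ (k * type A p a))
  mem-p^a⁺ {p} {a} k pp 0<a kt≤a with typeDiv A p a pp 0<a
  ... | divides i a≡i*t = subst (λ x → mem A (p ^ x) (p ^ (k * type A p a))) (sym a≡i*t)
          (proj₂ (typeSpec A p a pp 0<a i (≤-reflexive (sym a≡i*t)) _) (k , k≤i , refl))
    where
    k≤i : k ≤ i
    k≤i = *-cancelʳ-≤ k i (type A p a) {{>-nonZero (0<type pp 0<a)}}
            (subst (k * type A p a ≤_) a≡i*t kt≤a)

  mem-*⁺ : ∀ {m n e f} → Coprime m n → mem A m e → mem A n f → mem A (m * n) (e * f)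
  mem-*⁺ {m} {n} coprime e∈A f∈A = proj₂ (mult A m n coprime _) (_ , _ , e∈A , f∈A , refl)

  mem-*⁻ : ∀ {m n d} → Coprime m n → mem A (m * n) d →
           ∃[ e ] ∃[ f ] mem A m e × mem A n f × d ≡ e * f
  mem-*⁻ {m} {n} coprime = proj₁ (mult A m n coprime _)

  1∈A : ∀ {n} → 0 < n → mem A n 1
  1∈A {n} = <-rec (λ n → 0 < n → mem A n 1) step n
    where
    step : ∀ n → (∀ {m} → m < n → 0 < m → mem A m 1) → 0 < n → mem A n 1
    step 1 _ _ = proj₂ (memOne A 1) refl
    step n@(suc (suc _)) rec 0<n with ∃-prime-divisor (s≤s (s≤s z≤n))
    ... | p , pp , p∣n with n≡p^val*rest pp 0<n
    ...   | r , n≡p^v*r , p∤r = subst (λ x → mem A x 1) (sym n≡p^v*r)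
              (mem-*⁺ (p∤m⇒coprime[p^a,m] (val p n) pp p∤r) (mem-p^a⁺ 0 pp 0<v z≤n) (rec r<n 0<r))
      where
      0<v : 0 < val p n
      0<v = p∣n⇒0<val 0<n p∣n
      0<r : 0 < r
      0<r = m∣n⇒0<m 0<n (divides (p ^ val p n) n≡p^v*r)
      r<n : r < n
      r<n = subst (r <_) (trans (*-comm r _) (sym n≡p^v*r))
              (m<m*n r (p ^ val p n) {{>-nonZero 0<r}} (^-monoʳ-< p (prime>1 pp) 0<v))

  p^type∈A : ∀ {n p} → 0 < n → Prime p → p ∣ n → mem A n (p ^ typeAt n p)
  p^type∈A {n} {p} 0<n pp p∣n with n≡p^val*rest pp 0<n
  ... | r , n≡p^v*r , p∤r =
        subst₂ (mem A) (sym n≡p^v*r) (trans (*-identityʳ _) (cong (p ^_) (*-identityˡ t)))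
          (mem-*⁺ (p∤m⇒coprime[p^a,m] (val p n) pp p∤r)
            (mem-p^a⁺ 1 pp 0<v (subst (_≤ val p n) (sym (*-identityˡ t)) (type≤ pp 0<v)))
            (1∈A (m∣n⇒0<m 0<n (divides (p ^ val p n) n≡p^v*r))))
    where
    t : ℕ
    t = typeAt n p
    0<v : 0 < val p n
    0<v = p∣n⇒0<val 0<n p∣n

  p^type∣mem : ∀ {n d p} → 0 < n → mem A n d → Prime p → p ∣ d → p ^ typeAt n p ∣ d
  p^type∣mem {n} {d} {p} 0<n d∈A pp p∣d with n≡p^val*rest pp 0<n
  ... | r , n≡p^v*r , p∤r
    with mem-*⁻ (p∤m⇒coprime[p^a,m] (val p n) pp p∤r) (subst (λ x → mem A x d) n≡p^v*r d∈A)
  ...   | e , f , e∈A , f∈A , refl with euclidsLemma e f pp p∣d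
  ...     | inj₂ p∣f = contradiction (∣-trans p∣f (sub A r f f∈A)) p∤r
  ...     | inj₁ p∣e with mem-p^a⁻ pp (p∣n⇒0<val 0<n (∣-trans p∣d (sub A n d d∈A))) e∈A
  ...       | zero  , refl = contradiction p∣e (prime∤1 pp)
  ...       | suc k , refl = ∣m⇒∣m*n f (p^b∣p^a p (m≤m+n (typeAt n p) _))

  gcdA≡1⇔units : ∀ {j n} → 0 < n → gcdA A j n ≡ 1 ⇔ (∀ {d} → d ∣ j → mem A n d → d ≡ 1)
  gcdA≡1⇔units {j} {n} 0<n = mk⇔
    (λ gcdA≡1 {d} d∣j d∈A → ≤-antisym
      (subst (d ≤_) gcdA≡1
        (∈⇒≤foldr-⊔ _ (∈-filter⁺ P? (∣⇒∈-range1 0<n (sub A n d d∈A)) (d∣j , d∈A))))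
      (m∣n⇒0<m 0<n (sub A n d d∈A)))
    (λ units → ≤-antisym
      (foldr-⊔-≤ (All.tabulate λ d∈ →
        let _ , d∣j , d∈A = ∈-filter⁻ P? {xs = range1 n} d∈ in ≤-reflexive (units d∣j d∈A)))
      (∈⇒≤foldr-⊔ _ (∈-filter⁺ P? (∈-range1⁺ ≤-refl 0<n) (1∣ j , 1∈A 0<n))))
    where
    P? : Decidable (λ d → d ∣ j × mem A n d)
    P? d = (d ∣? j) ×-dec decMem A n d

  gcdA≡1⇔prime-powers : ∀ {j n} → 0 < n →
                        gcdA A j n ≡ 1 ⇔ (∀ {p} → Prime p → p ∣ n → ¬ p ^ typeAt n p ∣ j)
  gcdA≡1⇔prime-powers {j} {n} 0<n = mk⇔
    (λ gcdA≡1 {p} pp p∣n p^t∣j → prime∤1 pp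
      (subst (p ∣_) (to (gcdA≡1⇔units 0<n) gcdA≡1 p^t∣j (p^type∈A 0<n pp p∣n))
        (n∣n^k p (0<type pp (p∣n⇒0<val 0<n p∣n)))))
    (λ no-p^t → from (gcdA≡1⇔units 0<n) λ {d} d∣j d∈A →
      no-prime-divisor⇒≡1 (m∣n⇒0<m 0<n (sub A n d d∈A)) λ pp p∣d →
        no-p^t pp (∣-trans p∣d (sub A n d d∈A)) (∣-trans (p^type∣mem 0<n d∈A pp p∣d) d∣j))
    where open Equivalence

  gammaA∣⇔ : ∀ {n m} → 0 < n →
             gammaA A n ∣ m ⇔ (∀ {p} → Prime p → p ∣ n → p ^ coreExponent n p ∣ m)
  gammaA∣⇔ {n} {m} 0<n = mk⇔
    (λ γ∣m {p} pp p∣n → ∣-trans (∈⇒∣product (∈-map⁺ (λ p → p ^ coreExponent n p)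
                                          (∈-filter⁺ P? (∣⇒∈-range1 0<n p∣n) (pp , p∣n)))) γ∣m)
    (λ p^e∣m → product-of-prime-powers-∣ (coreExponent n) (Unique.filter⁺ P? (range1-unique n))
      (All.tabulate λ p∈ → proj₁ (proj₂ (∈-filter⁻ P? {xs = range1 n} p∈)))
      (All.tabulate λ p∈ → let _ , pp , p∣n = ∈-filter⁻ P? {xs = range1 n} p∈ in p^e∣m pp p∣n))
    where
    P? : Decidable (λ p → Prime p × p ∣ n)
    P? p = prime? p ×-dec (p ∣? n)

  p^type∤⇔p^core∣ : ∀ {j n m p} → 0 < n → gcd j n * m ≡ n → Prime p → p ∣ n →
                    (¬ p ^ typeAt n p ∣ j) ⇔ (p ^ coreExponent n p ∣ m)
  p^type∤⇔p^core∣ {j} {n} {m} {p} 0<n g*m≡n pp p∣n = mk⇔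
    (λ p^t∤j → p^a∣m*n∧p^t∤m⇒p^b∣n t pp t+e≡1+a (subst (p ^ val p n ∣_) (sym g*m≡n) (p^val∣n p n))
                 (λ p^t∣g → p^t∤j (∣-trans p^t∣g (gcd[m,n]∣m j n))))
    (λ p^e∣m p^t∣j → p^[1+val]∤n (prime>1 pp) 0<n
      (subst₂ _∣_ p^t*p^e≡p^[1+a] g*m≡n
        (*-pres-∣ (gcd-greatest p^t∣j (∣-trans (p^b∣p^a p t≤a) (p^val∣n p n))) p^e∣m)))
    where
    t : ℕ
    t = typeAt n p
    0<a : 0 < val p n
    0<a = p∣n⇒0<val 0<n p∣n
    t≤a : t ≤ val p n
    t≤a = type≤ pp 0<a
    t+e≡1+a : t + coreExponent n p ≡ suc (val p n)
    t+e≡1+a = t+[a∸t+1]≡1+a t≤a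
    p^t*p^e≡p^[1+a] : p ^ t * p ^ coreExponent n p ≡ p ^ suc (val p n)
    p^t*p^e≡p^[1+a] = trans (sym (^-distribˡ-+-* p t _)) (cong (p ^_) t+e≡1+a)

  gcdA≡1⇔gammaA∣ : ∀ {j n m} → 0 < n → gcd j n * m ≡ n → gcdA A j n ≡ 1 ⇔ gammaA A n ∣ m
  gcdA≡1⇔gammaA∣ 0<n g*m≡n = mk⇔
    (λ gcdA≡1 → from (gammaA∣⇔ 0<n) λ pp p∣n →
      to (p^type∤⇔p^core∣ 0<n g*m≡n pp p∣n) (to (gcdA≡1⇔prime-powers 0<n) gcdA≡1 pp p∣n))
    (λ γ∣m → from (gcdA≡1⇔prime-powers 0<n) λ pp p∣n →
      from (p^type∤⇔p^core∣ 0<n g*m≡n pp p∣n) (to (gammaA∣⇔ 0<n) γ∣m pp p∣n))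
    where open Equivalence

-- The partition of [1..n] according to n / gcd(j, n)

-- n / d, with the junk value 0 at d = 0
cofactor : ℕ → ℕ → ℕ
cofactor n zero      = 0
cofactor n d@(suc _) = n / d

coprimeResidues : ℕ → List ℕ
coprimeResidues d = filter (λ k → gcd k d ≟ 1) (range1 d)

block : ℕ → ℕ → List ℕ
block n d = map (cofactor n d *_) (coprimeResidues d)

divisorsSatisfying : ∀ {Q : Pred ℕ 0ℓ} → Decidable Q → ℕ → List ℕ
divisorsSatisfying Q? n = filter (λ d → (d ∣? n) ×-dec Q? d) (range1 n)

d*cofactor≡n : ∀ {d n} → 0 < d → d ∣ n → d * cofactor n d ≡ n
d*cofactor≡n {suc _} _ d∣n = m*[n/m]≡n d∣n

cofactor-unique : ∀ {d c n} → 0 < d → d * c ≡ n → cofactor n d ≡ c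
cofactor-unique {d@(suc _)} {c} _ refl = trans (cong (_/ d) (*-comm d c)) (m*n/n≡m c d)

gcd[k,d]≡1⇒gcd[c*k,c*d]≡c : ∀ {c k d} → gcd k d ≡ 1 → gcd (c * k) (c * d) ≡ c
gcd[k,d]≡1⇒gcd[c*k,c*d]≡c {c} {k} {d} gcd[k,d]≡1 = begin
  gcd (c * k) (c * d) ≡⟨ c*gcd[m,n]≡gcd[cm,cn] c k d ⟨
  c * gcd k d         ≡⟨ cong (c *_) gcd[k,d]≡1 ⟩
  c * 1               ≡⟨ *-identityʳ c ⟩
  c                   ∎
  where open ≡-Reasoning

gcd[c*k,c*d]≡c⇒gcd[k,d]≡1 : ∀ {c k d} → 0 < c → gcd (c * k) (c * d) ≡ c → gcd k d ≡ 1
gcd[c*k,c*d]≡c⇒gcd[k,d]≡1 {c} {k} {d} 0<c gcd≡c = *-cancelˡ-≡ (gcd k d) 1 c {{>-nonZero 0<c}}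
  (trans (c*gcd[m,n]≡gcd[cm,cn] c k d) (trans gcd≡c (sym (*-identityʳ c))))

module _ {n : ℕ} (0<n : 0 < n) {Q : Pred ℕ 0ℓ} (Q? : Decidable Q) where

  private
    D : List ℕ
    D = divisorsSatisfying Q? n
    P? : Decidable (λ d → d ∣ n × Q d)
    P? d = (d ∣? n) ×-dec Q? d

  divisor*cofactor≡n : ∀ {d} → d ∈ D → d * cofactor n d ≡ n
  divisor*cofactor≡n d∈D with ∈-filter⁻ P? {xs = range1 n} d∈D
  ... | d∈range , d∣n , _ = d*cofactor≡n (proj₁ (∈-range1⁻ d∈range)) d∣n

  0<cofactor : ∀ {d} → d ∈ D → 0 < cofactor n d
  0<cofactor {d} d∈D = m∣n⇒0<m 0<n (divides d (sym (divisor*cofactor≡n d∈D)))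

  ∈-block⁻ : ∀ {d j} → d ∈ D → j ∈ block n d → j ∈ range1 n × gcd j n * d ≡ n
  ∈-block⁻ {d} d∈D j∈block with ∈-map⁻ (cofactor n d *_) j∈block
  ... | k , k∈res , refl with ∈-filter⁻ (λ k → gcd k d ≟ 1) {xs = range1 d} k∈res
  ...   | k∈range , gcd[k,d]≡1 = j∈range , trans (cong (_* d) gcd≡c) c*d≡n
    where
    c : ℕ
    c = cofactor n d
    c*d≡n : c * d ≡ n
    c*d≡n = trans (*-comm c d) (divisor*cofactor≡n d∈D)
    gcd≡c : gcd (c * k) n ≡ c
    gcd≡c = subst (λ x → gcd (c * k) x ≡ c) c*d≡n (gcd[k,d]≡1⇒gcd[c*k,c*d]≡c gcd[k,d]≡1)
    j∈range : c * k ∈ range1 n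
    j∈range = ∈-range1⁺ (*-mono-≤ (0<cofactor d∈D) (proj₁ (∈-range1⁻ k∈range)))
                (subst (c * k ≤_) c*d≡n (*-monoʳ-≤ c (proj₂ (∈-range1⁻ k∈range))))

  ∈-blocks⇔ : ∀ {j} → j ∈ concatMap (block n) D ⇔
                      (j ∈ range1 n × ∃[ m ] gcd j n * m ≡ n × Q m)
  ∈-blocks⇔ {j} = mk⇔
    (λ j∈blocks → let d , d∈D , j∈block = find (∈-concatMap⁻ (block n) {xs = D} j∈blocks)
                      j∈range , g*d≡n = ∈-block⁻ d∈D j∈block
                  in j∈range , d , g*d≡n , proj₂ (proj₂ (∈-filter⁻ P? {xs = range1 n} d∈D)))
    (λ (j∈range , m , g*m≡n , Qm) →
      ∈-concatMap⁺ (block n) (lose (m∈D g*m≡n Qm) (j∈block j∈range g*m≡n)))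
    where
    m∣n : ∀ {m} → gcd j n * m ≡ n → m ∣ n
    m∣n g*m≡n = divides (gcd j n) (sym g*m≡n)
    m∈D : ∀ {m} → gcd j n * m ≡ n → Q m → m ∈ D
    m∈D g*m≡n Qm = ∈-filter⁺ P? (∣⇒∈-range1 0<n (m∣n g*m≡n)) (m∣n g*m≡n , Qm)
    j∈block : ∀ {m} → j ∈ range1 n → gcd j n * m ≡ n → j ∈ block n m
    j∈block {m} j∈range g*m≡n with gcd[m,n]∣m j n
    ... | divides k j≡k*g = subst (_∈ block n m) j≡c*k (∈-map⁺ (c *_) k∈res)
      where
      g c : ℕ
      g = gcd j n
      c = cofactor n m
      0<g : 0 < g
      0<g = m∣n⇒0<m 0<n (gcd[m,n]∣n j n)
      j≡g*k : j ≡ g * k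
      j≡g*k = trans j≡k*g (*-comm k g)
      c≡g : c ≡ g
      c≡g = cofactor-unique (m∣n⇒0<m 0<n (m∣n g*m≡n)) (trans (*-comm m g) g*m≡n)
      j≡c*k : c * k ≡ j
      j≡c*k = sym (trans j≡g*k (cong (_* k) (sym c≡g)))
      0<k : 0 < k
      0<k = m∣n⇒0<m (proj₁ (∈-range1⁻ j∈range)) (divides g j≡g*k)
      k≤m : k ≤ m
      k≤m = *-cancelˡ-≤ g {{>-nonZero 0<g}}
              (subst₂ _≤_ j≡g*k (sym g*m≡n) (proj₂ (∈-range1⁻ j∈range)))
      gcd[k,m]≡1 : gcd k m ≡ 1
      gcd[k,m]≡1 = gcd[c*k,c*d]≡c⇒gcd[k,d]≡1 0<g
                     (subst₂ (λ x y → gcd x y ≡ g) j≡g*k (sym g*m≡n) refl)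
      k∈res : k ∈ coprimeResidues m
      k∈res = ∈-filter⁺ (λ k → gcd k m ≟ 1) (∈-range1⁺ 0<k k≤m) gcd[k,m]≡1

  blocks-unique : Unique (concatMap (block n) D)
  blocks-unique = Unique-concatMap⁺ (block n) (Unique.filter⁺ P? (range1-unique n)) block-unique
    λ {d} {d′} {v} d∈D d′∈D v∈block v∈block′ →
      *-cancelˡ-≡ d d′ (gcd v n) {{>-nonZero (m∣n⇒0<m 0<n (gcd[m,n]∣n v n))}}
        (trans (proj₂ (∈-block⁻ d∈D v∈block)) (sym (proj₂ (∈-block⁻ d′∈D v∈block′))))
    where
    block-unique : ∀ {d} → d ∈ D → Unique (block n d)
    block-unique {d} d∈D = Unique.map⁺ (*-cancelˡ-≡ _ _ (cofactor n d) {{>-nonZero (0<cofactor d∈D)}})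
                                       (Unique.filter⁺ _ (range1-unique d))

A-residues↭blocks : ∀ A {n} → 0 < n →
                    filter (λ j → gcdA A j n ≟ 1) (range1 n) ↭
                    concatMap (block n) (divisorsSatisfying (gammaA A n ∣?_) n)
A-residues↭blocks A {n} 0<n =
  ∼bag⇒↭ (unique∧set⇒bag (Unique.filter⁺ J? (range1-unique n)) (blocks-unique 0<n γ∣?)
                         (mk⇔ J⊆blocks blocks⊆J))
  where
  open Equivalence
  J? : Decidable (λ j → gcdA A j n ≡ 1)
  J? j = gcdA A j n ≟ 1
  γ∣? : Decidable (gammaA A n ∣_)
  γ∣? = gammaA A n ∣?_
  J D : List ℕ
  J = filter J? (range1 n)
  D = divisorsSatisfying γ∣? n
  J⊆blocks : ∀ {j} → j ∈ J → j ∈ concatMap (block n) D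
  J⊆blocks {j} j∈J with ∈-filter⁻ J? {xs = range1 n} j∈J | gcd[m,n]∣n j n
  ... | j∈range , gcdA≡1 | divides m n≡m*g =
    from (∈-blocks⇔ 0<n γ∣?) (j∈range , m , g*m≡n , to (gcdA≡1⇔gammaA∣ A 0<n g*m≡n) gcdA≡1)
    where
    g*m≡n : gcd j n * m ≡ n
    g*m≡n = sym (trans n≡m*g (*-comm m _))
  blocks⊆J : ∀ {j} → j ∈ concatMap (block n) D → j ∈ J
  blocks⊆J j∈blocks with to (∈-blocks⇔ 0<n γ∣?) j∈blocks
  ... | j∈range , m , g*m≡n , γ∣m = ∈-filter⁺ J? j∈range (from (gcdA≡1⇔gammaA∣ A 0<n g*m≡n) γ∣m)


-- Polynomials as coefficient lists

module PolyProperties {c ℓ} (R : CommutativeRing c ℓ) where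
  private module R = CommutativeRing R
  open R using (_≈_; 0#; 1#; -_; setoid; semiring) renaming (Carrier to C; _+_ to _⊕_; _*_ to _⊗_)
  open Poly R
  import Algebra.Properties.Semiring.Exp semiring as Exp
  open import Data.List.Relation.Binary.Equality.Setoid setoid
    using (_≋_; ≋-refl; ≋-sym; ≋-trans; ≋-reflexive; ≋-setoid) public

  pow≡^ : ∀ x k → pow x k ≡ x Exp.^ k
  pow≡^ x zero    = refl
  pow≡^ x (suc k) = cong (x ⊗_) (pow≡^ x k)

  pow-of-root : ∀ {x y} c k → pow x c ≈ y → pow y k ≈ pow x (c * k)
  pow-of-root {x} {y} c k x^c≈y = begin
    pow y k              ≡⟨ pow≡^ y k ⟩
    y Exp.^ k            ≈⟨ Exp.^-congˡ k x^c≈y ⟨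
    pow x c Exp.^ k      ≡⟨ cong (Exp._^ k) (pow≡^ x c) ⟩
    (x Exp.^ c) Exp.^ k  ≈⟨ Exp.^-assocʳ x c k ⟩
    x Exp.^ (c * k)      ≡⟨ pow≡^ x (c * k) ⟨
    pow x (c * k)        ∎
    where open import Relation.Binary.Reasoning.Setoid setoid

  open import Relation.Binary.Reasoning.Setoid ≋-setoid

  infixr 30 _·P_
  _·P_ : C → Pol → Pol
  a ·P p = map (a ⊗_) p

  -- p *P [] is a list of zeros as long as p, so *P is associative on the nose only when the middle
  -- factor is a nonempty list.
  data NonEmpty : Pol → Set c where
    nonEmpty : ∀ {a p} → NonEmpty (a ∷ p)

  +P-identityʳ : ∀ p → p +P [] ≡ p
  +P-identityʳ []      = refl
  +P-identityʳ (_ ∷ _) = refl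

  +P-cong : ∀ {p p′ q q′} → p ≋ p′ → q ≋ q′ → p +P q ≋ p′ +P q′
  +P-cong []            q≋q′          = q≋q′
  +P-cong (a≈a′ ∷ p≋p′) []            = a≈a′ ∷ p≋p′
  +P-cong (a≈a′ ∷ p≋p′) (b≈b′ ∷ q≋q′) = R.+-cong a≈a′ b≈b′ ∷ +P-cong p≋p′ q≋q′

  +P-comm : ∀ p q → p +P q ≋ q +P p
  +P-comm []      q       = ≋-reflexive (sym (+P-identityʳ q))
  +P-comm (a ∷ p) []      = ≋-refl
  +P-comm (a ∷ p) (b ∷ q) = R.+-comm a b ∷ +P-comm p q

  +P-assoc : ∀ p q r → (p +P q) +P r ≋ p +P (q +P r)
  +P-assoc []      q       r       = ≋-refl
  +P-assoc (a ∷ p) []      r       = ≋-refl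
  +P-assoc (a ∷ p) (b ∷ q) []      = ≋-refl
  +P-assoc (a ∷ p) (b ∷ q) (c ∷ r) = R.+-assoc a b c ∷ +P-assoc p q r

  +P-interchange : ∀ p q r s → (p +P q) +P (r +P s) ≋ (p +P r) +P (q +P s)
  +P-interchange p q r s = begin
    (p +P q) +P (r +P s)  ≈⟨ +P-assoc p q (r +P s) ⟩
    p +P (q +P (r +P s))  ≈⟨ +P-cong (≋-refl {p}) (+P-assoc q r s) ⟨
    p +P ((q +P r) +P s)  ≈⟨ +P-cong (≋-refl {p}) (+P-cong (+P-comm q r) (≋-refl {s})) ⟩
    p +P ((r +P q) +P s)  ≈⟨ +P-cong (≋-refl {p}) (+P-assoc r q s) ⟩
    p +P (r +P (q +P s))  ≈⟨ +P-assoc p r (q +P s) ⟨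
    (p +P r) +P (q +P s)  ∎

  +P-zeroesʳ : ∀ p {z} → All (_≈ 0#) z → length z ≤ length p → p +P z ≋ p
  +P-zeroesʳ p       []           _         = ≋-reflexive (+P-identityʳ p)
  +P-zeroesʳ (a ∷ p) (b≈0 ∷ z≈0) (s≤s z≤p) =
    R.trans (R.+-cong R.refl b≈0) (R.+-identityʳ a) ∷ +P-zeroesʳ p z≈0 z≤p

  length≤length-+P : ∀ p q → length p ≤ length (p +P q)
  length≤length-+P []      q       = z≤n
  length≤length-+P (a ∷ p) []      = ≤-refl
  length≤length-+P (a ∷ p) (b ∷ q) = s≤s (length≤length-+P p q)

  ·P-cong : ∀ {a b p q} → a ≈ b → p ≋ q → a ·P p ≋ b ·P q
  ·P-cong a≈b []          = []
  ·P-cong a≈b (x≈y ∷ p≋q) = R.*-cong a≈b x≈y ∷ ·P-cong a≈b p≋q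

  ·P-distribˡ-+P : ∀ a p q → a ·P (p +P q) ≋ a ·P p +P a ·P q
  ·P-distribˡ-+P a []      q       = ≋-refl
  ·P-distribˡ-+P a (x ∷ p) []      = ≋-refl
  ·P-distribˡ-+P a (x ∷ p) (y ∷ q) = R.distribˡ a x y ∷ ·P-distribˡ-+P a p q

  ·P-distribʳ-⊕ : ∀ a b p → (a ⊕ b) ·P p ≋ a ·P p +P b ·P p
  ·P-distribʳ-⊕ a b []      = []
  ·P-distribʳ-⊕ a b (x ∷ p) = R.distribʳ x a b ∷ ·P-distribʳ-⊕ a b p

  ·P-assoc : ∀ a b p → a ·P b ·P p ≋ (a ⊗ b) ·P p
  ·P-assoc a b []      = []
  ·P-assoc a b (x ∷ p) = R.sym (R.*-assoc a b x) ∷ ·P-assoc a b p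

  ·P-identityˡ : ∀ p → 1# ·P p ≋ p
  ·P-identityˡ []      = []
  ·P-identityˡ (x ∷ p) = R.*-identityˡ x ∷ ·P-identityˡ p

  0·P-zeroes : ∀ p → All (_≈ 0#) (0# ·P p)
  0·P-zeroes []      = []
  0·P-zeroes (x ∷ p) = R.zeroˡ x ∷ 0·P-zeroes p

  *P-cong : ∀ {p p′ q q′} → p ≋ p′ → q ≋ q′ → p *P q ≋ p′ *P q′
  *P-cong []            q≋q′ = []
  *P-cong (a≈a′ ∷ p≋p′) q≋q′ = +P-cong (·P-cong a≈a′ q≋q′) (R.refl ∷ *P-cong p≋p′ q≋q′)

  *P-·P : ∀ a p q → (a ·P p) *P q ≋ a ·P (p *P q)
  *P-·P a []      q = []
  *P-·P a (x ∷ p) q = begin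
    (a ⊗ x) ·P q +P (0# ∷ ((a ·P p) *P q))
      ≈⟨ +P-cong (·P-assoc a x q) (R.zeroʳ a ∷ ≋-sym (*P-·P a p q)) ⟨
    a ·P x ·P q +P a ·P (0# ∷ (p *P q))
      ≈⟨ ·P-distribˡ-+P a (x ·P q) (0# ∷ (p *P q)) ⟨
    a ·P (x ·P q +P (0# ∷ (p *P q)))
      ∎

  *P-distribʳ-+P : ∀ p q r → (p +P q) *P r ≋ (p *P r) +P (q *P r)
  *P-distribʳ-+P []      q       r = ≋-refl
  *P-distribʳ-+P (a ∷ p) []      r = ≋-reflexive (sym (+P-identityʳ _))
  *P-distribʳ-+P (a ∷ p) (b ∷ q) r = begin
    (a ⊕ b) ·P r +P (0# ∷ ((p +P q) *P r))
      ≈⟨ +P-cong (·P-distribʳ-⊕ a b r) (R.sym (R.+-identityʳ 0#) ∷ *P-distribʳ-+P p q r) ⟩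
    (a ·P r +P b ·P r) +P ((0# ∷ (p *P r)) +P (0# ∷ (q *P r)))
      ≈⟨ +P-interchange (a ·P r) (b ·P r) _ _ ⟩
    (a ·P r +P (0# ∷ (p *P r))) +P (b ·P r +P (0# ∷ (q *P r)))
      ∎

  length≤length-*P : ∀ {q} r → NonEmpty q → length r ≤ length (q *P r)
  length≤length-*P {b ∷ q} r nonEmpty =
    subst (_≤ length (b ·P r +P (0# ∷ (q *P r)))) (length-map (b ⊗_) r) (length≤length-+P (b ·P r) _)

  *P-assoc : ∀ p q r → NonEmpty q → (p *P q) *P r ≋ p *P (q *P r)
  *P-assoc []      q r _ = []
  *P-assoc (a ∷ p) q r q≠[] = begin
    (a ·P q +P (0# ∷ (p *P q))) *P r
      ≈⟨ *P-distribʳ-+P (a ·P q) _ r ⟩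
    ((a ·P q) *P r) +P (0# ·P r +P (0# ∷ ((p *P q) *P r)))
      ≈⟨ +P-cong (*P-·P a q r) (≋-refl {0# ·P r +P _}) ⟩
    a ·P (q *P r) +P (0# ·P r +P (0# ∷ ((p *P q) *P r)))
      ≈⟨ +P-assoc (a ·P (q *P r)) (0# ·P r) _ ⟨
    (a ·P (q *P r) +P 0# ·P r) +P (0# ∷ ((p *P q) *P r))
      ≈⟨ +P-cong (+P-zeroesʳ (a ·P (q *P r)) (0·P-zeroes r) 0r≤aqr) (R.refl ∷ *P-assoc p q r q≠[]) ⟩
    a ·P (q *P r) +P (0# ∷ (p *P (q *P r)))
      ∎
    where
    0r≤aqr : length (0# ·P r) ≤ length (a ·P (q *P r))
    0r≤aqr = subst₂ _≤_ (sym (length-map (0# ⊗_) r)) (sym (length-map (a ⊗_) (q *P r)))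
               (length≤length-*P r q≠[])

  *P-identityˡ : ∀ {q} → NonEmpty q → (1# ∷ []) *P q ≋ q
  *P-identityˡ {a ∷ q} nonEmpty =
    R.trans (R.+-identityʳ _) (R.*-identityˡ a)
    ∷ ≋-trans (≋-reflexive (+P-identityʳ (1# ·P q))) (·P-identityˡ q)

  +P-∷-nonEmpty : ∀ p {a q} → NonEmpty (p +P (a ∷ q))
  +P-∷-nonEmpty []      = nonEmpty
  +P-∷-nonEmpty (_ ∷ _) = nonEmpty

  X-a*X-b-comm : ∀ a b → (X- a) *P (X- b) ≋ (X- b) *P (X- a)
  X-a*X-b-comm a b =
    R.+-cong (R.*-comm (- a) (- b)) R.refl
    ∷ R.trans (linear-coefficient a b) (R.trans (R.+-comm (- a) (- b)) (R.sym (linear-coefficient b a)))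
    ∷ R.refl ∷ []
    where
    linear-coefficient : ∀ a b → ((- a) ⊗ 1#) ⊕ ((1# ⊗ (- b)) ⊕ 0#) ≈ (- a) ⊕ (- b)
    linear-coefficient a b = R.+-cong (R.*-identityʳ (- a)) (R.trans (R.+-identityʳ _) (R.*-identityˡ (- b)))

  ∏X- : List C → Pol
  ∏X- as = prodP (map X-_ as)

  ∏X--nonEmpty : ∀ as → NonEmpty (∏X- as)
  ∏X--nonEmpty []       = nonEmpty
  ∏X--nonEmpty (a ∷ as) = +P-∷-nonEmpty ((- a) ·P ∏X- as)

  ∏X--map-cong : ∀ {A : Set} {f g : A → C} → (∀ x → f x ≈ g x) → ∀ xs →
                 ∏X- (map f xs) ≋ ∏X- (map g xs)
  ∏X--map-cong f≈g []       = ≋-refl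
  ∏X--map-cong f≈g (x ∷ xs) = *P-cong (R.-‿cong (f≈g x) ∷ R.refl ∷ []) (∏X--map-cong f≈g xs)

  ∏X--↭ : ∀ {as bs} → as ↭ bs → ∏X- as ≋ ∏X- bs
  ∏X--↭ ↭.refl                = ≋-refl
  ∏X--↭ (↭.prep a as↭bs)      = *P-cong (≋-refl {X- a}) (∏X--↭ as↭bs)
  ∏X--↭ (↭.swap {xs = as} {ys = bs} a b as↭bs) = begin
    (X- a) *P ((X- b) *P ∏X- as)    ≈⟨ *P-assoc (X- a) (X- b) (∏X- as) nonEmpty ⟨
    ((X- a) *P (X- b)) *P ∏X- as    ≈⟨ *P-cong (X-a*X-b-comm a b) (∏X--↭ as↭bs) ⟩
    ((X- b) *P (X- a)) *P ∏X- bs    ≈⟨ *P-assoc (X- b) (X- a) (∏X- bs) nonEmpty ⟩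
    (X- b) *P ((X- a) *P ∏X- bs)    ∎
  ∏X--↭ (↭.trans as↭bs bs↭cs) = ≋-trans (∏X--↭ as↭bs) (∏X--↭ bs↭cs)

  ∏X--++ : ∀ as bs → ∏X- (as ++ bs) ≋ ∏X- as *P ∏X- bs
  ∏X--++ []       bs = ≋-sym (*P-identityˡ (∏X--nonEmpty bs))
  ∏X--++ (a ∷ as) bs = begin
    (X- a) *P ∏X- (as ++ bs)         ≈⟨ *P-cong (≋-refl {X- a}) (∏X--++ as bs) ⟩
    (X- a) *P (∏X- as *P ∏X- bs)     ≈⟨ *P-assoc (X- a) (∏X- as) (∏X- bs) (∏X--nonEmpty as) ⟨
    ((X- a) *P ∏X- as) *P ∏X- bs     ∎

  ∏X--concatMap : ∀ {A : Set} (f : A → List C) xs → ∏X- (concatMap f xs) ≋ prodP (map (∏X- ∘ f) xs)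
  ∏X--concatMap f []       = ≋-refl
  ∏X--concatMap f (x ∷ xs) =
    ≋-trans (∏X--++ (f x) (concatMap f xs)) (*P-cong (≋-refl {∏X- (f x)}) (∏X--concatMap f xs))

  prodP-map-cong : ∀ {A : Set} {f g : A → Pol} {xs} → All (λ x → f x ≋ g x) xs →
                   prodP (map f xs) ≋ prodP (map g xs)
  prodP-map-cong []              = ≋-refl
  prodP-map-cong (fx≋gx ∷ fs≋gs) = *P-cong fx≋gx (prodP-map-cong fs≋gs)


  cyclo≋∏X-block : ∀ {ζ n d} → RootFamily ζ → 0 < n → d * cofactor n d ≡ n →
                   cyclo ζ d ≋ ∏X- (map (pow (ζ n)) (block n d))
  cyclo≋∏X-block {ζ} {n} {d} ζ-family 0<n d*c≡n = begin
    cyclo ζ d                                           ≡⟨ cong prodP (map-∘ ks) ⟩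
    ∏X- (map (pow (ζ d)) ks)                            ≈⟨ ∏X--map-cong ζ_d^k≈ζ_n^ck ks ⟩
    ∏X- (map (pow (ζ n) ∘ (cofactor n d *_)) ks)        ≡⟨ cong ∏X- (map-∘ ks) ⟩
    ∏X- (map (pow (ζ n)) (block n d))                   ∎
    where
    ks : List ℕ
    ks = coprimeResidues d
    ζ_d^k≈ζ_n^ck : ∀ k → pow (ζ d) k ≈ pow (ζ n) (cofactor n d * k)
    ζ_d^k≈ζ_n^ck k =
      pow-of-root (cofactor n d) k (RootFamily.coherent ζ-family n d (cofactor n d) 0<n d*c≡n)

theorem2 : ∀ {c ℓ} (R : CommutativeRing c ℓ) (ζ : ℕ → CommutativeRing.Carrier R) →
             Poly.RootFamily R ζ → (A : RegularSystem) → (n : ℕ) → 1 ≤ n →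
             Pointwise (CommutativeRing._≈_ R) (Poly.cycloA R ζ A n) (Poly.cycloProd R ζ A n)
theorem2 R ζ ζ-family A n 0<n = begin
  cycloA ζ A n                             ≡⟨ cong prodP (map-∘ J) ⟩
  ∏X- (map ζₙ^ J)                          ≈⟨ ∏X--↭ (↭ₚ.map⁺ ζₙ^ (A-residues↭blocks A 0<n)) ⟩
  ∏X- (map ζₙ^ (concatMap (block n) D))    ≡⟨ cong ∏X- (map-concatMap ζₙ^ (block n) D) ⟩
  ∏X- (concatMap (map ζₙ^ ∘ block n) D)    ≈⟨ ∏X--concatMap (map ζₙ^ ∘ block n) D ⟩
  prodP (map (∏X- ∘ map ζₙ^ ∘ block n) D)  ≈⟨ prodP-map-cong (All.tabulate cyclo≋block) ⟨
  cycloProd ζ A n                          ∎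
  where
  open Poly R
  open PolyProperties R
  open import Relation.Binary.Reasoning.Setoid ≋-setoid
  ζₙ^ : ℕ → CommutativeRing.Carrier R
  ζₙ^ = pow (ζ n)
  γ∣? : Decidable (gammaA A n ∣_)
  γ∣? = gammaA A n ∣?_
  J D : List ℕ
  J = filter (λ j → gcdA A j n ≟ 1) (range1 n)
  D = divisorsSatisfying γ∣? n
  cyclo≋block : ∀ {d} → d ∈ D → cyclo ζ d ≋ ∏X- (map ζₙ^ (block n d))
  cyclo≋block {d} d∈D = cyclo≋∏X-block {d = d} ζ-family 0<n (divisor*cofactor≡n 0<n γ∣? d∈D)
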